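{- Let $\mathfrak G$ be the digraph of order $n\ge1$ associated to a rooted tree with root $v$. Then $T_{\mathfrak G,v}(X)=\sigma(\mathfrak G)L_{n-1}(-X)$, where $L_{n-1}$ is the $(n-1)$-th Laguerre polynomial.
   Context: The digraph associated to a rooted tree (a connected acyclic graph with a distinguished vertex $v$, the root) orients each edge from its endpoint closer to the root to the other endpoint. For a finite simple digraph $\mathfrak G=(V,A)$ with $|V|=n$, a disposition is a bijection $f:V\to\{1,\dots,n\}$ with $f(v_1)>f(v_2)$ whenever $(v_1,v_2)\in A$, and $\sigma(\mathfrak G)$ is the number of dispositions. For $v\in V$ and $i\ge0$, $\mathfrak G_i$ is obtained from $\mathfrak G$ by adding new vertices $z_1,\dots,z_i$ and arcs $(z_0,z_1),\dots,(z_{i-1},z_i)$ with $z_0=v$. The companion polynomial $T_{\mathfrak G,v}(X)$ is the (polynomial) power series satisfying $\sum_{i\ge0}\sigma(\mathfrak G_i)X^i/i!=T_{\mathfrak G,v}(X)\exp(X)$. The Laguerre polynomial is $L_m(X)=\sum_{k=0}^{m}\binom{m}{k}\frac{(-1)^k}{k!}X^k$. -}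

module Defs where

open import Data.Bool using (Bool; true; false; T; T?; _∧_)
open import Data.Nat as ℕ using (ℕ; zero; suc; _∸_; _!; _≡ᵇ_)
open import Data.Nat.Properties using (_!≢0)
open import Data.Nat.Combinatorics using (_C_)
open import Data.Fin as Fin using (Fin; toℕ; splitAt; _<_; _≟_)
open import Data.Fin.Properties using (all?; any?)
open import Data.Sum using (inj₁; inj₂)
open import Data.Product using (Σ; ∃; _×_; _,_)
open import Data.List using (List; []; _∷_; map; concatMap; filter; length; allFin)
open import Data.List using () renaming ([_] to singleton)
open import Data.Vec.Functional using () renaming (_∷_ to _∷ᶠ_)
open import Data.Integer as ℤ using (ℤ; +_)
open import Data.Rational as ℚ using (ℚ; 0ℚ; 1ℚ; _+_; _*_; -_; _/_)
open import Function using (_∘_)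
open import Function.Bundles using (_⇔_)
open import Relation.Nullary using (Dec; ¬_)
open import Relation.Nullary.Decidable using (_×-dec_; _→-dec_; isYes)
open import Relation.Binary.PropositionalEquality using (_≡_; _≢_)

Digraph : ℕ → Set
Digraph n = Fin n → Fin n → Bool

Arc : ∀ {n} → Digraph n → Fin n → Fin n → Set
Arc G a b = T (G a b)

-- Dispositions.  A disposition is a bijection f : V → {1,…,n}; we use
-- the order-isomorphic codomain Fin n = {0,…,n-1}.  The condition is
-- f a > f b for every arc (a , b).

IsBijection : ∀ {n} → (Fin n → Fin n) → Set
IsBijection {n} f = (∀ x y → f x ≡ f y → x ≡ y) × (∀ y → ∃ λ x → f x ≡ y)

IsDisposition : ∀ {n} → Digraph n → (Fin n → Fin n) → Set
IsDisposition G f = IsBijection f × (∀ a b → Arc G a b → f b < f a)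

isBijection? : ∀ {n} (f : Fin n → Fin n) → Dec (IsBijection f)
isBijection? f =
  all? (λ x → all? (λ y → (f x ≟ f y) →-dec (x ≟ y)))
  ×-dec all? (λ y → any? (λ x → f x ≟ y))

isDisposition? : ∀ {n} (G : Digraph n) (f : Fin n → Fin n) → Dec (IsDisposition G f)
isDisposition? G f =
  isBijection? f ×-dec all? (λ a → all? (λ b → T? (G a b) →-dec (f b Fin.<? f a)))

allFuns : ∀ m k → List (Fin m → Fin k)
allFuns zero    k = singleton (λ ())
allFuns (suc m) k =
  concatMap (λ f → map (λ c → c ∷ᶠ f) (allFin k)) (allFuns m k)

σ : ∀ {n} → Digraph n → ℕ
σ {n} G = length (filter (isDisposition? G) (allFuns n n))

-- G_i : add new vertices z_1,…,z_i (z_j is the vertex n + (j-1) of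
-- Fin (n + i)) and arcs (z_0 , z_1), …, (z_{i-1} , z_i) with z_0 = v.

extend : ∀ {n} → Digraph n → Fin n → (i : ℕ) → Digraph (n ℕ.+ i)
extend {n} G v i x y with splitAt n x | splitAt n y
... | inj₁ a | inj₁ b = G a b
... | inj₁ a | inj₂ k = (toℕ k ≡ᵇ 0) ∧ isYes (a ≟ v)
... | inj₂ j | inj₁ b = false
... | inj₂ j | inj₂ k = toℕ k ≡ᵇ suc (toℕ j)

-- Rational power series are represented by coefficient sequences ℕ → ℚ.

Σ≤ : ℕ → (ℕ → ℚ) → ℚ
Σ≤ zero    f = f 0
Σ≤ (suc i) f = Σ≤ i f + f (suc i)

inv! : ℕ → ℚ
inv! k = (+ 1) / (k !)
  where instance _ = k !≢0

mulExpCoeff : (ℕ → ℚ) → ℕ → ℚ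
mulExpCoeff t i = Σ≤ i (λ k → t k * inv! (i ∸ k))

dispSeriesCoeff : ∀ {n} → Digraph n → Fin n → ℕ → ℚ
dispSeriesCoeff G v i = ((+ σ (extend G v i)) / 1) * inv! i

-- t is a companion series of (G , v):  Σ σ(G_i) X^i/i!  =  t(X) exp(X)
IsCompanion : ∀ {n} → Digraph n → Fin n → (ℕ → ℚ) → Set
IsCompanion G v t = ∀ i → mulExpCoeff t i ≡ dispSeriesCoeff G v i

-- Laguerre polynomial L_m(X) = Σ_{k=0}^m C(m,k) (-1)^k X^k / k!,
-- as a coefficient sequence (zero for k > m since m C k = 0 then).

sign : ℕ → ℚ
sign zero    = 1ℚ
sign (suc k) = - sign k

laguerre : ℕ → ℕ → ℚ
laguerre m k = ((+ (m C k)) / 1) * sign k * inv! k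

negArg : (ℕ → ℚ) → ℕ → ℚ
negArg p k = sign k * p k

-- A rooted tree on the vertex set Fin n with root r is
-- given by a parent map p (with p r = r as a convention) such that every
-- vertex reaches the root by iterating p.  Its edges are {u , p u} for
-- u ≢ r.  The associated digraph orients each edge from the endpoint
-- closer to the root (the parent p u) to the other endpoint (u).

iter : ∀ {n} → (Fin n → Fin n) → ℕ → Fin n → Fin n
iter p zero    u = u
iter p (suc k) u = p (iter p k u)

IsParentMap : ∀ {n} → Fin n → (Fin n → Fin n) → Set
IsParentMap r p = (p r ≡ r) × (∀ u → ∃ λ k → iter p k u ≡ r)

IsRootedTreeDigraph : ∀ {n} → Digraph n → Fin n → Set
IsRootedTreeDigraph {n} G r =
  Σ (Fin n → Fin n) λ p →
    IsParentMap r p × (∀ a b → Arc G a b ⇔ ((b ≢ r) × (p b ≡ a)))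

-- "T_{G,v}(X) = s(X)": s satisfies the defining identity of the companion
-- series, and it is the (unique) such series.
CompanionIs : ∀ {n} → Digraph n → Fin n → (ℕ → ℚ) → Set
CompanionIs G v s = IsCompanion G v s × (∀ t → IsCompanion G v t → ∀ k → t k ≡ s k)

σℚ : ∀ {n} → Digraph n → ℚ
σℚ G = (+ σ G) / 1

-- In a disposition of a rooted tree the root gets the top label.  In G_{i+1} the new vertex
-- z_{i+1} is a leaf below z_i, so deleting it together with its label c is a bijection onto
-- the dispositions of G_i in which z_i has label ≥ c.  Hence the number σ≥ i c of dispositions
-- of G_i with label(z_i) ≥ c satisfies σ≥ (i+1) c = Σ_{c′ ≥ c} σ≥ i c′, and the hockey-stick
-- identity gives σ≥ i c = σ(G) C(n-1+i-c, i); in particular σ(G_i) = σ≥ i 0 = σ(G) C(n-1+i, i).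
-- By Vandermonde, C(n-1+i, i) = Σ_k C(n-1,k) C(i,k), which is i! times the coefficient of X^i
-- in L_{n-1}(-X) e^X.  The companion series is unique because multiplication by e^X acts
-- triangularly, with unit diagonal, on coefficient sequences.
module Submission where

module Counting where

  open import Data.Nat using (ℕ; zero; suc; _+_; _≤_; _<_; _≟_; z≤n; s≤s)
  open import Data.Nat.Properties
  open import Algebra.Properties.CommutativeSemigroup +-commutativeSemigroup
    using () renaming (interchange to +-interchange)
  open import Data.Fin using (Fin; zero; suc)
  open import Data.Fin.Properties using (injective⇒≤)
  open import Data.List using (List; []; _∷_; map; length; filter; lookup; allFin)
  open import Data.List.Properties using (filter-≐; filter-none)
  open import Data.List.Relation.Binary.Disjoint.Setoid using (Disjoint)
  open import Data.List.Relation.Unary.All as All using (All; []; _∷_)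
  open import Data.List.Relation.Unary.All.Properties using (all-filter) renaming (map⁺ to All-map⁺)
  open import Data.List.Relation.Unary.Any as Any using (Any; here; index)
  open import Data.List.Relation.Unary.Any.Properties
    using (lookup-index; concatMap⁺) renaming (map⁺ to Any-map⁺; map⁻ to Any-map⁻)
  open import Data.List.Relation.Unary.AllPairs as AllPairs using ([]; _∷_)
  import Data.List.Relation.Unary.AllPairs.Properties as AllPairs
  open import Data.List.Relation.Unary.Unique.Setoid using (Unique)
  import Data.List.Relation.Unary.Unique.Setoid.Properties as Unique
  open import Data.List.Relation.Unary.Unique.Propositional.Properties using (allFin⁺)
  open import Data.List.Membership.Propositional.Properties using (∈-lookup; ∈-allFin)
  import Data.List.Membership.Setoid.Properties as Membership
  open import Data.Product using (Σ; _×_; _,_; proj₁; proj₂)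
  open import Data.Vec.Functional using () renaming (_∷_ to _∷ᶠ_)
  open import Function using (_∘_; Injection; Inverse)
  open import Function.Properties.Inverse using (Inverse⇒Injection)
  import Function.Construct.Symmetry as Symmetry
  open import Level using (0ℓ)
  open import Relation.Binary using (Setoid; _Respects_)
  import Relation.Binary.Construct.On as On
  open import Relation.Binary.PropositionalEquality
  open import Relation.Nullary using (¬_; yes; no; contradiction)
  open import Relation.Nullary.Decidable using (_×-dec_; ¬?)
  open import Relation.Unary using (Pred; Decidable; _≐_)
  open import Defs using (allFuns)

  ∑ : ℕ → (ℕ → ℕ) → ℕ
  ∑ zero    f = 0
  ∑ (suc k) f = f 0 + ∑ k (f ∘ suc)

  syntax ∑ k (λ j → e) = ∑[ j < k ] e

  ∑-cong : ∀ k {f g : ℕ → ℕ} → (∀ j → j < k → f j ≡ g j) → ∑ k f ≡ ∑ k g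
  ∑-cong zero    f≡g = refl
  ∑-cong (suc k) f≡g = cong₂ _+_ (f≡g 0 (s≤s z≤n)) (∑-cong k (λ j j<k → f≡g (suc j) (s≤s j<k)))

  ∑-zero : ∀ k → ∑[ j < k ] 0 ≡ 0
  ∑-zero zero    = refl
  ∑-zero (suc k) = ∑-zero k

  ∑-distrib-+ : ∀ k (f g : ℕ → ℕ) → ∑[ j < k ] (f j + g j) ≡ ∑ k f + ∑ k g
  ∑-distrib-+ zero    f g = refl
  ∑-distrib-+ (suc k) f g =
    trans (cong (f 0 + g 0 +_) (∑-distrib-+ k (f ∘ suc) (g ∘ suc))) (+-interchange (f 0) (g 0) _ _)

  ∑-snoc : ∀ k (f : ℕ → ℕ) → ∑ (suc k) f ≡ ∑ k f + f k
  ∑-snoc zero    f = +-comm (f 0) 0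
  ∑-snoc (suc k) f = trans (cong (f 0 +_) (∑-snoc k (f ∘ suc))) (sym (+-assoc (f 0) _ _))

  module _ {A : Set} where

    length-filter-≐ : ∀ {P Q : Pred A 0ℓ} (P? : Decidable P) (Q? : Decidable Q) → P ≐ Q →
                      ∀ xs → length (filter P? xs) ≡ length (filter Q? xs)
    length-filter-≐ P? Q? P≐Q xs = cong length (filter-≐ P? Q? P≐Q xs)

    length-filter-split : ∀ {P Q : Pred A 0ℓ} (P? : Decidable P) (Q? : Decidable Q) xs →
      length (filter P? xs) ≡
      length (filter (λ x → P? x ×-dec Q? x) xs) + length (filter (λ x → P? x ×-dec ¬? (Q? x)) xs)
    length-filter-split P? Q? []       = refl
    length-filter-split P? Q? (x ∷ xs) with P? x | Q? x
    ... | yes _ | yes _ = cong suc (length-filter-split P? Q? xs)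
    ... | yes _ | no _  = trans (cong suc (length-filter-split P? Q? xs)) (sym (+-suc _ _))
    ... | no _  | _     = length-filter-split P? Q? xs

    length-filter-by-value : ∀ {P : Pred A 0ℓ} (P? : Decidable P) (h : A → ℕ) c k →
      (∀ {x} → P x → c ≤ h x × h x < c + k) →
      ∀ xs → length (filter P? xs) ≡ ∑[ j < k ] length (filter (λ x → P? x ×-dec (h x ≟ c + j)) xs)
    length-filter-by-value {P} P? h c zero bounds xs =
      cong length (filter-none P? (All.universal out-of-range xs))
      where
      out-of-range : ∀ x → ¬ P x
      out-of-range x Px with bounds Px
      ... | c≤hx , hx<c+0 = <⇒≱ hx<c+0 (subst (_≤ h x) (sym (+-identityʳ c)) c≤hx)
    length-filter-by-value {P} P? h c (suc k) bounds xs = begin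
      length (filter P? xs)
        ≡⟨ length-filter-split P? (λ x → h x ≟ c) xs ⟩
      length (filter (λ x → P? x ×-dec (h x ≟ c)) xs) + length (filter P≢? xs)
        ≡⟨ cong₂ _+_ (length-filter-≐ _ _ ((λ (p , e) → p , trans e (sym (+-identityʳ c))) ,
                                           (λ (p , e) → p , trans e (+-identityʳ c))) xs)
                     (length-filter-by-value P≢? h (suc c) k bounds≢ xs) ⟩
      length (filter (λ x → P? x ×-dec (h x ≟ c + 0)) xs) +
        ∑[ j < k ] length (filter (λ x → P≢? x ×-dec (h x ≟ suc c + j)) xs)
        ≡⟨ cong (_ +_) (∑-cong k (λ j _ → length-filter-≐ _ _ (shift j) xs)) ⟩
      ∑[ j < suc k ] length (filter (λ x → P? x ×-dec (h x ≟ c + j)) xs) ∎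
      where
      open ≡-Reasoning
      P≢? : Decidable (λ x → P x × ¬ h x ≡ c)
      P≢? x = P? x ×-dec ¬? (h x ≟ c)

      bounds≢ : ∀ {x} → P x × ¬ h x ≡ c → suc c ≤ h x × h x < suc c + k
      bounds≢ {x} (Px , hx≢c) with bounds Px
      ... | c≤hx , hx<c+1+k = ≤∧≢⇒< c≤hx (hx≢c ∘ sym) , subst (h x <_) (+-suc c k) hx<c+1+k

      shift : ∀ j → (λ x → (P x × ¬ h x ≡ c) × h x ≡ suc c + j) ≐ (λ x → P x × h x ≡ c + suc j)
      shift j = (λ ((p , _) , e) → p , trans e (sym (+-suc c j))) ,
                (λ (p , e) → (p , λ e′ → m≢1+m+n c (trans (sym e′) (trans e (+-suc c j)))) , trans e (+-suc c j))

  lookup-injective : ∀ {a ℓ} (S : Setoid a ℓ) {xs} → Unique S xs →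
                     ∀ i j → Setoid._≈_ S (lookup xs i) (lookup xs j) → i ≡ j
  lookup-injective S (_ ∷ _)  zero    zero    _   = refl
  lookup-injective S (x≉ ∷ _) zero    (suc j) x≈y = contradiction x≈y (All.lookup x≉ (∈-lookup j))
  lookup-injective S (x≉ ∷ _) (suc i) zero    y≈x = contradiction (Setoid.sym S y≈x) (All.lookup x≉ (∈-lookup i))
  lookup-injective S (_ ∷ u)  (suc i) (suc j) x≈y = cong suc (lookup-injective S u i j x≈y)

  Functions : ℕ → ℕ → Setoid 0ℓ 0ℓ
  Functions m k = Fin m →-setoid Fin k

  _∈ᶠ_ : ∀ {m k} → (Fin m → Fin k) → List (Fin m → Fin k) → Set
  f ∈ᶠ fs = Any (f ≗_) fs

  allFuns-complete : ∀ m k (f : Fin m → Fin k) → f ∈ᶠ allFuns m k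
  allFuns-complete zero    k f = here (λ ())
  allFuns-complete (suc m) k f =
    concatMap⁺ _ (Any.map (λ f∘suc≗g → Any-map⁺ (Any.map (λ { refl → head∷ f∘suc≗g }) (∈-allFin (f zero))))
                          (allFuns-complete m k (f ∘ suc)))
    where
    head∷ : ∀ {g} → f ∘ suc ≗ g → f ≗ (f zero ∷ᶠ g)
    head∷ _       zero    = refl
    head∷ f∘suc≗g (suc x) = f∘suc≗g x

  allFuns-unique : ∀ m k → Unique (Functions m k) (allFuns m k)
  allFuns-unique zero    k = [] ∷ []
  allFuns-unique (suc m) k =
    Unique.concat⁺ (Functions (suc m) k)
      (All-map⁺ (All.universal row-unique (allFuns m k)))
      (AllPairs.map⁺ (AllPairs.map rows-disjoint (allFuns-unique m k)))
    where
    row : (Fin m → Fin k) → List (Fin (suc m) → Fin k)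
    row g = map (_∷ᶠ g) (allFin k)

    row-unique : ∀ g → Unique (Functions (suc m) k) (row g)
    row-unique g = Unique.map⁺ (setoid (Fin k)) (Functions (suc m) k) (λ c∷g≗c′∷g → c∷g≗c′∷g zero) (allFin⁺ k)

    tail-∈-row : ∀ {f g} → f ∈ᶠ row g → f ∘ suc ≗ g
    tail-∈-row f∈row = proj₂ (Any.satisfied (Any-map⁻ f∈row)) ∘ suc

    rows-disjoint : ∀ {g g′} → ¬ (g ≗ g′) → Disjoint (Functions (suc m) k) (row g) (row g′)
    rows-disjoint g≉g′ (f∈row-g , f∈row-g′) =
      g≉g′ (λ x → trans (sym (tail-∈-row f∈row-g x)) (tail-∈-row f∈row-g′ x))

  Satisfying : ∀ {m} → Pred (Fin m → Fin m) 0ℓ → Setoid 0ℓ 0ℓ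
  Satisfying {m} P = On.setoid (Functions m m) (proj₁ {B = P})

  count : ∀ {m} {P : Pred (Fin m → Fin m) 0ℓ} → Decidable P → ℕ
  count {m} P? = length (filter P? (allFuns m m))

  count-↣ : ∀ {a b} {P : Pred (Fin a → Fin a) 0ℓ} {Q : Pred (Fin b → Fin b) 0ℓ} (P? : Decidable P) (Q? : Decidable Q) →
            Q Respects _≗_ → Injection (Satisfying P) (Satisfying Q) → count P? ≤ count Q?
  count-↣ {a} {b} {P} P? Q? Q-resp ι = injective⇒≤ {f = position} position-injective
    where
    open Injection ι using (to; injective)
    xs = filter P? (allFuns a a)
    ys = filter Q? (allFuns b b)

    element : Fin (length xs) → Σ _ P
    element i = lookup xs i , All.lookup (all-filter P? (allFuns a a)) (∈-lookup i)

    image-∈ : ∀ i → proj₁ (to (element i)) ∈ᶠ ys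
    image-∈ i = Membership.∈-filter⁺ (Functions b b) Q? Q-resp (allFuns-complete b b _) (proj₂ (to (element i)))

    position : Fin (length xs) → Fin (length ys)
    position i = index (image-∈ i)

    position-injective : ∀ {i j} → position i ≡ position j → i ≡ j
    position-injective {i} {j} eq =
      lookup-injective (Functions a a) (Unique.filter⁺ (Functions a a) P? (allFuns-unique a a)) i j
        (injective {element i} {element j} λ x →
          trans (lookup-index (image-∈ i) x) (trans (cong (λ k → lookup ys k x) eq) (sym (lookup-index (image-∈ j) x))))

  count-↔ : ∀ {a b} {P : Pred (Fin a → Fin a) 0ℓ} {Q : Pred (Fin b → Fin b) 0ℓ} (P? : Decidable P) (Q? : Decidable Q) →
            P Respects _≗_ → Q Respects _≗_ → Inverse (Satisfying P) (Satisfying Q) → count P? ≡ count Q?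
  count-↔ P? Q? P-resp Q-resp ι =
    ≤-antisym (count-↣ P? Q? Q-resp (Inverse⇒Injection ι))
              (count-↣ Q? P? P-resp (Inverse⇒Injection (Symmetry.inverse ι)))

  count-≐ : ∀ {m} {P Q : Pred (Fin m → Fin m) 0ℓ} (P? : Decidable P) (Q? : Decidable Q) → P ≐ Q → count P? ≡ count Q?
  count-≐ {m} P? Q? P≐Q = length-filter-≐ P? Q? P≐Q (allFuns m m)

module Binomial where

  open import Data.Nat using (ℕ; zero; suc; _+_; _*_; _∸_; _!; _≤_)
  open import Data.Nat.Properties
  open import Algebra.Properties.CommutativeSemigroup +-commutativeSemigroup using (x∙yz≈y∙xz)
  open import Data.Nat.Combinatorics using (_C_; nCk≡n!/k![n-k]!; k![n∸k]!∣n!; nCk+nC[k+1]≡[n+1]C[k+1])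
  open import Data.Nat.DivMod using (m/n*n≡m)
  open import Relation.Binary.PropositionalEquality
  open Counting using (∑; ∑-cong; ∑-zero; ∑-distrib-+)

  nCk*k!*[n∸k]!≡n! : ∀ {n k} → k ≤ n → (n C k) * (k ! * (n ∸ k) !) ≡ n !
  nCk*k!*[n∸k]!≡n! {n} {k} k≤n =
    trans (cong (_* (k ! * (n ∸ k) !)) (nCk≡n!/k![n-k]! k≤n)) (m/n*n≡m {{k !* (n ∸ k) !≢0}} (k![n∸k]!∣n! k≤n))

  vandermonde : ∀ a b r → ∑[ k < suc r ] ((a C k) * (b C (r ∸ k))) ≡ (a + b) C r
  vandermonde zero    b r       = trans (cong₂ _+_ (+-identityʳ (b C r)) (∑-zero r)) (+-identityʳ (b C r))
  vandermonde (suc a) b zero    = refl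
  vandermonde (suc a) b (suc r) = begin
    1 * (b C suc r) + ∑[ k < suc r ] ((suc a C suc k) * (b C (r ∸ k)))
      ≡⟨ cong (1 * (b C suc r) +_) (∑-cong (suc r) (λ k _ → cong (_* (b C (r ∸ k))) (sym (nCk+nC[k+1]≡[n+1]C[k+1] a k)))) ⟩
    1 * (b C suc r) + ∑[ k < suc r ] ((a C k + a C suc k) * (b C (r ∸ k)))
      ≡⟨ cong (1 * (b C suc r) +_) (trans (∑-cong (suc r) (λ k _ → *-distribʳ-+ (b C (r ∸ k)) (a C k) (a C suc k)))
                                          (∑-distrib-+ (suc r) lower upper)) ⟩
    1 * (b C suc r) + (∑ (suc r) lower + ∑ (suc r) upper)
      ≡⟨ x∙yz≈y∙xz (1 * (b C suc r)) (∑ (suc r) lower) (∑ (suc r) upper) ⟩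
    ∑[ k < suc r ] ((a C k) * (b C (r ∸ k))) + ∑[ k < suc (suc r) ] ((a C k) * (b C (suc r ∸ k)))
      ≡⟨ cong₂ _+_ (vandermonde a b r) (vandermonde a b (suc r)) ⟩
    (a + b) C r + (a + b) C suc r
      ≡⟨ nCk+nC[k+1]≡[n+1]C[k+1] (a + b) r ⟩
    (suc a + b) C suc r ∎
    where
    open ≡-Reasoning
    lower upper : ℕ → ℕ
    lower k = (a C k) * (b C (r ∸ k))
    upper k = (a C suc k) * (b C (r ∸ k))

  ∑-hockey-stick : ∀ (u : ℕ → ℕ) s i T →
    (∀ c d → c + d ≡ T → u c ≡ s * (d C i)) → u (suc T) ≡ 0 →
    ∀ c d → c + d ≡ suc T → ∑[ j < suc d ] u (c + j) ≡ s * (d C suc i)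
  ∑-hockey-stick u s i T u-closed u-top c zero    c+0≡1+T =
    trans (+-identityʳ (u (c + 0))) (trans (cong u c+0≡1+T) (trans u-top (sym (*-zeroʳ s))))
  ∑-hockey-stick u s i T u-closed u-top c (suc d) c+1+d≡1+T = begin
    u (c + 0) + ∑[ j < suc d ] u (c + suc j)
      ≡⟨ cong₂ _+_ (cong u (+-identityʳ c)) (∑-cong (suc d) (λ j _ → cong u (+-suc c j))) ⟩
    u c + ∑[ j < suc d ] u (suc c + j)
      ≡⟨ cong₂ _+_ (u-closed c d c+d≡T)
                   (∑-hockey-stick u s i T u-closed u-top (suc c) d (trans (sym (+-suc c d)) c+1+d≡1+T)) ⟩
    s * (d C i) + s * (d C suc i)
      ≡⟨ sym (*-distribˡ-+ s _ _) ⟩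
    s * (d C i + d C suc i)
      ≡⟨ cong (s *_) (nCk+nC[k+1]≡[n+1]C[k+1] d i) ⟩
    s * (suc d C suc i) ∎
    where
    open ≡-Reasoning
    c+d≡T : c + d ≡ T
    c+d≡T = suc-injective (trans (sym (+-suc c d)) c+1+d≡1+T)

module Dispositions where

  open import Data.Bool using (T; _∧_)
  open import Data.Nat as ℕ using (ℕ; zero; suc; _+_; _*_; _≤_; _<_; _≡ᵇ_; _≤?_; z≤n; s≤s)
  open import Data.Nat.Properties
  open import Data.Nat.Combinatorics using (_C_)
  open import Data.Fin as Fin
    using (Fin; zero; suc; toℕ; fromℕ; fromℕ<; inject₁; cast; punchIn; punchOut; splitAt; _↑ˡ_; _↑ʳ_)
  open import Data.Fin.Properties
    using (toℕ<n; toℕ-fromℕ; toℕ-fromℕ<; toℕ-cast; toℕ-inject₁; toℕ-↑ˡ; toℕ-↑ʳ; toℕ-injective; cast-is-id;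
           splitAt-↑ˡ; splitAt-↑ʳ; splitAt⁻¹-↑ˡ; splitAt⁻¹-↑ʳ; ↑ˡ-injective;
           punchInᵢ≢i; punchIn-injective; punchOut-injective; punchOut-cong; punchOut-punchIn; punchIn-punchOut;
           punchIn-cancel-≤; punchOut-cancel-≤)
  open import Data.List using (length)
  open import Data.List.Properties using (filter-none)
  import Data.List.Relation.Unary.All as All
  open import Data.Product using (Σ; ∃; _×_; _,_; proj₁; proj₂)
  open import Data.Sum as Sum using (inj₁; inj₂)
  open import Data.Sum.Properties using (map₁₂-map₂₁; inj₂-injective)
  open import Function using (_∘_; _⇔_; mk⇔; Inverse; Equivalence; Congruent)
  import Function.Consequences.Setoid as Consequences
  open import Level using (0ℓ)
  open import Relation.Binary using (Setoid; _Respects_)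
  open import Relation.Binary.PropositionalEquality
  open import Relation.Nullary using (¬_; yes; no; contradiction)
  open import Relation.Nullary.Decidable using (_×-dec_)
  open import Relation.Unary using (Pred; Decidable)
  open import Defs
  open Counting
  open Binomial using (∑-hockey-stick)

  private variable m : ℕ

  IsDisposition-resp-≗ : ∀ {H : Digraph m} → IsDisposition H Respects _≗_
  IsDisposition-resp-≗ f≗g ((inj , surj) , arcs) =
    ((λ x y gx≡gy → inj x y (trans (f≗g x) (trans gx≡gy (sym (f≗g y))))) ,
     (λ y → let (x , fx≡y) = surj y in x , trans (sym (f≗g x)) fx≡y)) ,
    (λ a b arc → subst₂ Fin._<_ (f≗g b) (f≗g a) (arcs a b arc))

  IsDisposition-resp-arcs : ∀ {H H′ : Digraph m} {f} → (∀ a b → H a b ≡ H′ a b) → IsDisposition H f → IsDisposition H′ f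
  IsDisposition-resp-arcs H≡H′ (bij , arcs) = bij , λ a b arc → arcs a b (subst T (sym (H≡H′ a b)) arc)

  σ[_∣_∈_] : ∀ {S : Pred ℕ 0ℓ} → Digraph m → Fin m → Decidable S → ℕ
  σ[ H ∣ u ∈ S? ] = count (λ f → isDisposition? H f ×-dec S? (toℕ (f u)))

  σ[_∣_≡_] : Digraph m → Fin m → ℕ → ℕ
  σ[ H ∣ u ≡ s ] = σ[ H ∣ u ∈ (ℕ._≟ s) ]

  σ[_∣_≥_] : Digraph m → Fin m → ℕ → ℕ
  σ[ H ∣ u ≥ c ] = σ[ H ∣ u ∈ (c ≤?_) ]

  σ[∣≥m]≡0 : ∀ (H : Digraph m) u → σ[ H ∣ u ≥ m ] ≡ 0
  σ[∣≥m]≡0 {m} H u = cong length (filter-none _ (All.universal (λ f (_ , m≤fu) → <⇒≱ (toℕ<n (f u)) m≤fu) (allFuns m m)))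

  relabel : ∀ {m′} → m ≡ m′ → Digraph m′ → Digraph m
  relabel p H x y = H (cast p x) (cast p y)

  σ-relabel : ∀ {m′} {S : Pred ℕ 0ℓ} (S? : Decidable S) (p : m ≡ m′) (H : Digraph m′) (u : Fin m) →
              σ[ H ∣ cast p u ∈ S? ] ≡ σ[ relabel p H ∣ u ∈ S? ]
  σ-relabel {m} {S = S} S? refl H u = count-≐ {m} _ _ (to , from)
    where
    H≡relabel : ∀ a b → H a b ≡ relabel refl H a b
    H≡relabel a b = sym (cong₂ H (cast-is-id refl a) (cast-is-id refl b))
    to : ∀ {f} → IsDisposition H f × S (toℕ (f (cast refl u))) → IsDisposition (relabel refl H) f × S (toℕ (f u))
    to {f} (d , s) = IsDisposition-resp-arcs H≡relabel d , subst (S ∘ toℕ ∘ f) (cast-is-id refl u) s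
    from : ∀ {f} → IsDisposition (relabel refl H) f × S (toℕ (f u)) → IsDisposition H f × S (toℕ (f (cast refl u)))
    from {f} (d , s) = IsDisposition-resp-arcs (λ a b → sym (H≡relabel a b)) d , subst (S ∘ toℕ ∘ f) (sym (cast-is-id refl u)) s

  punchIn-mono-< : ∀ {n} (i : Fin (suc n)) {j k : Fin n} → j Fin.< k → punchIn i j Fin.< punchIn i k
  punchIn-mono-< i j<k = ≰⇒> (λ pk≤pj → <⇒≱ j<k (punchIn-cancel-≤ i _ _ pk≤pj))

  punchOut-mono-< : ∀ {n} {i j k : Fin (suc n)} (i≢j : i ≢ j) (i≢k : i ≢ k) → j Fin.< k → punchOut i≢j Fin.< punchOut i≢k
  punchOut-mono-< i≢j i≢k j<k = ≰⇒> (λ pk≤pj → <⇒≱ j<k (punchOut-cancel-≤ i≢k i≢j pk≤pj))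

  ≤⇒<punchIn : ∀ {n} (i : Fin (suc n)) (j : Fin n) → i Fin.≤ j → i Fin.< punchIn i j
  ≤⇒<punchIn zero    j       _         = s≤s z≤n
  ≤⇒<punchIn (suc i) (suc j) (s≤s i≤j) = s≤s (≤⇒<punchIn i j i≤j)

  <⇒≤punchOut : ∀ {n} {i j : Fin (suc n)} (i≢j : i ≢ j) → i Fin.< j → i Fin.≤ punchOut i≢j
  <⇒≤punchOut {i = zero}  {suc j} _   _         = z≤n
  <⇒≤punchOut {suc n} {suc i} {suc j} i≢j (s≤s i<j) = s≤s (<⇒≤punchOut (i≢j ∘ cong suc) i<j)

  -- The vertices of H are those of H′ other than ℓ, enumerated by punchIn ℓ.
  record IsPendantExtension (H : Digraph m) (w : Fin m) (H′ : Digraph (suc m)) (ℓ : Fin (suc m)) : Set where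
    field
      restriction : ∀ x y → H′ (punchIn ℓ x) (punchIn ℓ y) ≡ H x y
      ℓ-is-sink   : ∀ y → ¬ Arc H′ ℓ y
      arc-into-ℓ  : ∀ x → Arc H′ (punchIn ℓ x) ℓ ⇔ x ≡ w

  module PendantRemoval {H : Digraph m} {w} {H′ : Digraph (suc m)} {ℓ}
                        (pendant : IsPendantExtension H w H′ ℓ) (c : Fin (suc m)) where
    open IsPendantExtension pendant

    Fixing : Pred (Fin (suc m) → Fin (suc m)) 0ℓ
    Fixing f = IsDisposition H′ f × toℕ (f ℓ) ≡ toℕ c

    Above : Pred (Fin m → Fin m) 0ℓ
    Above g = IsDisposition H g × toℕ c ≤ toℕ (g w)

    module _ (f : Fin (suc m) → Fin (suc m)) (f-fixing : Fixing f) where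
      private
        f-inj  = proj₁ (proj₁ (proj₁ f-fixing))
        f-surj = proj₂ (proj₁ (proj₁ f-fixing))
        f-arcs = proj₂ (proj₁ f-fixing)

      fℓ≡c : f ℓ ≡ c
      fℓ≡c = toℕ-injective (proj₂ f-fixing)

      c≢f∘punchIn : ∀ x → c ≢ f (punchIn ℓ x)
      c≢f∘punchIn x c≡f = punchInᵢ≢i ℓ x (f-inj _ _ (trans (sym c≡f) (sym fℓ≡c)))

      removeℓ : Fin m → Fin m
      removeℓ x = punchOut (c≢f∘punchIn x)

      removeℓ-above : Above removeℓ
      removeℓ-above = ((injective , surjective) , arcs) , above
        where
        injective : ∀ x y → removeℓ x ≡ removeℓ y → x ≡ y
        injective x y eq =
          punchIn-injective ℓ x y (f-inj _ _ (punchOut-injective (c≢f∘punchIn x) (c≢f∘punchIn y) eq))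

        surjective : ∀ y → ∃ λ x → removeℓ x ≡ y
        surjective y with f-surj (punchIn c y)
        ... | x′ , fx′≡ = punchOut ℓ≢x′ ,
              trans (punchOut-cong c (trans (cong f (punchIn-punchOut ℓ≢x′)) fx′≡)) (punchOut-punchIn c)
          where
          ℓ≢x′ : ℓ ≢ x′
          ℓ≢x′ refl = punchInᵢ≢i c y (trans (sym fx′≡) fℓ≡c)

        arcs : ∀ a b → Arc H a b → removeℓ b Fin.< removeℓ a
        arcs a b arc = punchOut-mono-< (c≢f∘punchIn b) (c≢f∘punchIn a) (f-arcs _ _ (subst T (sym (restriction a b)) arc))

        above : toℕ c ≤ toℕ (removeℓ w)
        above = <⇒≤punchOut (c≢f∘punchIn w)
                  (subst (Fin._< f (punchIn ℓ w)) fℓ≡c (f-arcs _ _ (Equivalence.from (arc-into-ℓ w) refl)))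

    insertℓ : (Fin m → Fin m) → Fin (suc m) → Fin (suc m)
    insertℓ g y with ℓ Fin.≟ y
    ... | yes _   = c
    ... | no ℓ≢y = punchIn c (g (punchOut ℓ≢y))

    insertℓ-ℓ : ∀ g → insertℓ g ℓ ≡ c
    insertℓ-ℓ g with ℓ Fin.≟ ℓ
    ... | yes _   = refl
    ... | no ℓ≢ℓ = contradiction refl ℓ≢ℓ

    insertℓ-punchIn : ∀ g x → insertℓ g (punchIn ℓ x) ≡ punchIn c (g x)
    insertℓ-punchIn g x with ℓ Fin.≟ punchIn ℓ x
    ... | yes ℓ≡ = contradiction (sym ℓ≡) (punchInᵢ≢i ℓ x)
    ... | no _   = cong (punchIn c ∘ g) (trans (punchOut-cong ℓ refl) (punchOut-punchIn ℓ))

    insertℓ-fixing : ∀ g → Above g → Fixing (insertℓ g)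
    insertℓ-fixing g (((g-inj , g-surj) , g-arcs) , c≤gw) = ((injective , surjective) , arcs) , cong toℕ (insertℓ-ℓ g)
      where
      injective : ∀ y y′ → insertℓ g y ≡ insertℓ g y′ → y ≡ y′
      injective y y′ eq with ℓ Fin.≟ y | ℓ Fin.≟ y′
      ... | yes ℓ≡y | yes ℓ≡y′ = trans (sym ℓ≡y) ℓ≡y′
      ... | yes _   | no _      = contradiction (sym eq) (punchInᵢ≢i c _)
      ... | no _    | yes _     = contradiction eq (punchInᵢ≢i c _)
      ... | no ℓ≢y  | no ℓ≢y′  = punchOut-injective ℓ≢y ℓ≢y′ (g-inj _ _ (punchIn-injective c _ _ eq))

      surjective : ∀ z → ∃ λ y → insertℓ g y ≡ z
      surjective z with c Fin.≟ z
      ... | yes c≡z = ℓ , trans (insertℓ-ℓ g) c≡z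
      ... | no c≢z  with g-surj (punchOut c≢z)
      ...   | x , gx≡ = punchIn ℓ x , trans (insertℓ-punchIn g x) (trans (cong (punchIn c) gx≡) (punchIn-punchOut c≢z))

      arcs : ∀ a b → Arc H′ a b → insertℓ g b Fin.< insertℓ g a
      arcs a b arc with ℓ Fin.≟ a | ℓ Fin.≟ b
      ... | yes refl | _        = contradiction arc (ℓ-is-sink b)
      ... | no ℓ≢a   | yes refl = ≤⇒<punchIn c _ (subst (λ x → toℕ c ≤ toℕ (g x)) (sym a≡w) c≤gw)
        where
        a≡w : punchOut ℓ≢a ≡ w
        a≡w = Equivalence.to (arc-into-ℓ _) (subst (λ x → Arc H′ x ℓ) (sym (punchIn-punchOut ℓ≢a)) arc)
      ... | no ℓ≢a   | no ℓ≢b  = punchIn-mono-< c (g-arcs _ _ (subst T (restriction _ _)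
              (subst₂ (Arc H′) (sym (punchIn-punchOut ℓ≢a)) (sym (punchIn-punchOut ℓ≢b)) arc)))

    insertℓ-removeℓ : ∀ f (p : Fixing f) → insertℓ (removeℓ f p) ≗ f
    insertℓ-removeℓ f p y with ℓ Fin.≟ y
    ... | yes refl = sym (fℓ≡c f p)
    ... | no ℓ≢y  = trans (punchIn-punchOut (c≢f∘punchIn f p _)) (cong f (punchIn-punchOut ℓ≢y))

    removeℓ-insertℓ : ∀ g (p : Fixing (insertℓ g)) → removeℓ (insertℓ g) p ≗ g
    removeℓ-insertℓ g p x = trans (punchOut-cong c (insertℓ-punchIn g x)) (punchOut-punchIn c)

    insertℓ-cong : ∀ {g g′} → g ≗ g′ → insertℓ g ≗ insertℓ g′
    insertℓ-cong g≗g′ y with ℓ Fin.≟ y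
    ... | yes _ = refl
    ... | no _  = cong (punchIn c) (g≗g′ _)

    -- The implicit arguments are passed by hand: an element of Σ _ Fixing is not determined by the
    -- pointwise class of its first component, so Agda cannot infer them from the setoid equality.
    fixing↔above : Inverse (Satisfying Fixing) (Satisfying Above)
    fixing↔above = record
      { to        = to
      ; from      = from
      ; to-cong   = λ {x} {y} → to-cong {x} {y}
      ; from-cong = insertℓ-cong
      ; inverse   = (λ {x} {y} → strictlyInverseˡ⇒inverseˡ {f = to} {f⁻¹ = from} (λ {x} {y} → to-cong {x} {y})
                                   (λ (g , q) → removeℓ-insertℓ g (insertℓ-fixing g q)) {x} {y}) ,
                    (λ {x} {y} → strictlyInverseʳ⇒inverseʳ {f⁻¹ = from} {f = to} insertℓ-cong
                                   (λ (f , p) → insertℓ-removeℓ f p) {x} {y})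
      }
      where
      open Consequences (Satisfying Fixing) (Satisfying Above)
      to : Σ _ Fixing → Σ _ Above
      to (f , p) = removeℓ f p , removeℓ-above f p
      from : Σ _ Above → Σ _ Fixing
      from (g , q) = insertℓ g , insertℓ-fixing g q
      to-cong : Congruent (Setoid._≈_ (Satisfying Fixing)) (Setoid._≈_ (Satisfying Above)) to
      to-cong f≗f′ x = punchOut-cong c (f≗f′ (punchIn ℓ x))

    σ-fixing≡σ-above : σ[ H′ ∣ ℓ ≡ toℕ c ] ≡ σ[ H ∣ w ≥ toℕ c ]
    σ-fixing≡σ-above = count-↔ _ _ fixing-resp above-resp fixing↔above
      where
      fixing-resp : Fixing Respects _≗_
      fixing-resp f≗f′ (d , e) = IsDisposition-resp-≗ f≗f′ d , trans (cong toℕ (sym (f≗f′ ℓ))) e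
      above-resp : Above Respects _≗_
      above-resp g≗g′ (d , e) = IsDisposition-resp-≗ g≗g′ d , subst (λ k → toℕ c ≤ toℕ k) (g≗g′ w) e

  σ-pendant : ∀ {H : Digraph m} {w H′ ℓ} → IsPendantExtension H w H′ ℓ →
              ∀ {s} → s < suc m → σ[ H′ ∣ ℓ ≡ s ] ≡ σ[ H ∣ w ≥ s ]
  σ-pendant {H = H} {w} {H′} {ℓ} pendant s<1+m =
    subst (λ s → σ[ H′ ∣ ℓ ≡ s ] ≡ σ[ H ∣ w ≥ s ]) (toℕ-fromℕ< s<1+m)
          (PendantRemoval.σ-fixing≡σ-above pendant (fromℕ< s<1+m))

  punchIn-fromℕ : ∀ {m} (x : Fin m) → punchIn (fromℕ m) x ≡ inject₁ x
  punchIn-fromℕ zero    = refl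
  punchIn-fromℕ (suc x) = cong suc (punchIn-fromℕ x)

  splitAt-cast-punchIn-fromℕ : ∀ n {i} .(p : suc (n + i) ≡ n + suc i) (x : Fin (n + i)) →
    splitAt n (cast p (punchIn (fromℕ (n + i)) x)) ≡ Sum.map₂ inject₁ (splitAt n x)
  splitAt-cast-punchIn-fromℕ zero    p x       = cong inj₂ (trans (cast-is-id p _) (punchIn-fromℕ x))
  splitAt-cast-punchIn-fromℕ (suc n) p zero    = refl
  splitAt-cast-punchIn-fromℕ (suc n) p (suc x) =
    trans (cong (Sum.map₁ suc) (splitAt-cast-punchIn-fromℕ n (suc-injective p) x)) (map₁₂-map₂₁ (splitAt n x))

  splitAt-cast-fromℕ : ∀ n {i} .(p : suc (n + i) ≡ n + suc i) → splitAt n (cast p (fromℕ (n + i))) ≡ inj₂ (fromℕ i)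
  splitAt-cast-fromℕ zero    p = cong inj₂ (cast-is-id p _)
  splitAt-cast-fromℕ (suc n) p = cong (Sum.map₁ suc) (splitAt-cast-fromℕ n (suc-injective p))

  module Chain {n} (G : Digraph n) (v : Fin n) where

    chainEnd : ∀ i → Fin (n + i)
    chainEnd zero    = v ↑ˡ 0
    chainEnd (suc i) = n ↑ʳ fromℕ i

    private
      p : ∀ i → suc (n + i) ≡ n + suc i
      p i = sym (+-suc n i)
      old : ∀ i → Fin (n + i) → Fin (n + suc i)
      old i x = cast (p i) (punchIn (fromℕ (n + i)) x)
      new : ∀ i → Fin (n + suc i)
      new i = cast (p i) (fromℕ (n + i))

    extend-old : ∀ i x y → extend G v (suc i) (old i x) (old i y) ≡ extend G v i x y
    extend-old i x y rewrite splitAt-cast-punchIn-fromℕ n (p i) x | splitAt-cast-punchIn-fromℕ n (p i) y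
      with splitAt n x | splitAt n y
    ... | inj₁ a | inj₁ b = refl
    ... | inj₁ a | inj₂ k = cong (λ t → (t ≡ᵇ 0) ∧ _) (toℕ-inject₁ k)
    ... | inj₂ j | inj₁ b = refl
    ... | inj₂ j | inj₂ k = cong₂ (λ s t → s ≡ᵇ suc t) (toℕ-inject₁ k) (toℕ-inject₁ j)

    new-is-sink : ∀ i y → ¬ T (extend G v (suc i) (new i) y)
    new-is-sink i y rewrite splitAt-cast-fromℕ n (p i) with splitAt n y
    ... | inj₁ b = λ ()
    ... | inj₂ k = λ arc → <⇒≢ (toℕ<n k) (trans (≡ᵇ⇒≡ _ _ arc) (cong suc (toℕ-fromℕ i)))

    arc-into-new : ∀ i x → T (extend G v (suc i) (old i x) (new i)) ⇔ x ≡ chainEnd i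
    arc-into-new i x rewrite splitAt-cast-punchIn-fromℕ n (p i) x | splitAt-cast-fromℕ n (p i)
      with splitAt n x in eq
    arc-into-new zero    x | inj₁ a with a Fin.≟ v
    ... | yes refl = mk⇔ (λ _ → sym (splitAt⁻¹-↑ˡ eq)) (λ _ → _)
    ... | no a≢v   = mk⇔ (λ ()) (λ x≡ → a≢v (↑ˡ-injective 0 a v (trans (splitAt⁻¹-↑ˡ eq) x≡)))
    arc-into-new (suc i) x | inj₁ a =
      mk⇔ (λ ()) (λ x≡ → contradiction (trans (sym eq) (trans (cong (splitAt n) x≡) (splitAt-↑ʳ n _ _))) λ ())
    arc-into-new (suc i) x | inj₂ j = mk⇔
      (λ arc → trans (sym (splitAt⁻¹-↑ʳ eq))
                     (cong (n ↑ʳ_) (toℕ-injective (trans (sym (toℕ-inject₁ j)) (sym (≡ᵇ⇒≡ _ _ arc))))))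
      (λ x≡ → ≡⇒≡ᵇ _ _ (trans (cong toℕ (inj₂-injective (trans (sym (splitAt-↑ʳ n _ _)) (trans (cong (splitAt n) (sym x≡)) eq))))
                              (sym (toℕ-inject₁ j))))

    new≡chainEnd : ∀ i → new i ≡ chainEnd (suc i)
    new≡chainEnd i = toℕ-injective (trans (toℕ-cast (p i) _) (trans (toℕ-fromℕ (n + i))
                       (sym (trans (toℕ-↑ʳ n (fromℕ i)) (cong (n +_) (toℕ-fromℕ i))))))

    extend-pendant : ∀ i → IsPendantExtension (extend G v i) (chainEnd i) (relabel (p i) (extend G v (suc i))) (fromℕ (n + i))
    extend-pendant i = record
      { restriction = extend-old i
      ; ℓ-is-sink   = new-is-sink i ∘ cast (p i)
      ; arc-into-ℓ  = arc-into-new i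
      }

    cast-↑ˡ : ∀ .(q : n ≡ n + 0) x → cast q x ≡ x ↑ˡ 0
    cast-↑ˡ q x = toℕ-injective (trans (toℕ-cast q x) (sym (toℕ-↑ˡ x 0)))

    extend-zero : ∀ x y → relabel (sym (+-identityʳ n)) (extend G v 0) x y ≡ G x y
    extend-zero x y rewrite cast-↑ˡ (sym (+-identityʳ n)) x | cast-↑ˡ (sym (+-identityʳ n)) y
                          | splitAt-↑ˡ n x 0 | splitAt-↑ˡ n y 0 = refl

  module _ {a} {G : Digraph (suc a)} {r} (tree : IsRootedTreeDigraph G r) {f} (disp : IsDisposition G f) where
    private
      parent       = proj₁ tree
      parent-root  = proj₁ (proj₁ (proj₂ tree))
      reaches-root = proj₂ (proj₁ (proj₂ tree))
      arc⇔         = proj₂ (proj₂ tree)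

    label-≤-parent : ∀ u → f u Fin.≤ f (parent u)
    label-≤-parent u with u Fin.≟ r
    ... | yes refl = ≤-reflexive (cong (toℕ ∘ f) (sym parent-root))
    ... | no u≢r   = <⇒≤ (proj₂ disp _ _ (Equivalence.from (arc⇔ (parent u) u) (u≢r , refl)))

    label-≤-ancestor : ∀ k u → f u Fin.≤ f (iter parent k u)
    label-≤-ancestor zero    u = ≤-refl
    label-≤-ancestor (suc k) u = ≤-trans (label-≤-ancestor k u) (label-≤-parent (iter parent k u))

    root-label : toℕ (f r) ≡ a
    root-label with proj₂ (proj₁ disp) (fromℕ a)
    ... | u , fu≡a with reaches-root u
    ...   | k , iter≡r = ≤-antisym (≤-pred (toℕ<n (f r)))
      (subst₂ _≤_ (trans (cong toℕ fu≡a) (toℕ-fromℕ a)) (cong (toℕ ∘ f) iter≡r) (label-≤-ancestor k u))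

  module _ {a} {G : Digraph (suc a)} {v} (tree : IsRootedTreeDigraph G v) where
    open Chain G v
    private
      n = suc a

    σ≥ : ℕ → ℕ → ℕ
    σ≥ i c = σ[ extend G v i ∣ chainEnd i ≥ c ]

    σ≥-zero : ∀ c → c ≤ a → σ≥ 0 c ≡ σ G
    σ≥-zero c c≤a = begin
      σ[ extend G v 0 ∣ chainEnd 0 ≥ c ]
        ≡⟨ cong (σ[ extend G v 0 ∣_≥ c ]) (sym (cast-↑ˡ q v)) ⟩
      σ[ extend G v 0 ∣ cast q v ≥ c ]
        ≡⟨ σ-relabel (c ≤?_) q (extend G v 0) v ⟩
      σ[ relabel q (extend G v 0) ∣ v ≥ c ]
        ≡⟨ count-≐ {n} _ _ ((λ (d , _) → IsDisposition-resp-arcs extend-zero d) ,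
                            (λ d → IsDisposition-resp-arcs (λ x y → sym (extend-zero x y)) d ,
                                   subst (c ≤_) (sym (root-label tree d)) c≤a)) ⟩
      σ G ∎
      where
      open ≡-Reasoning
      q : n ≡ n + 0
      q = sym (+-identityʳ n)

    σ≥-suc : ∀ i c k → c + k ≡ n + suc i → σ≥ (suc i) c ≡ ∑[ j < k ] σ≥ i (c + j)
    σ≥-suc i c k c+k≡ = begin
      σ≥ (suc i) c
        ≡⟨ length-filter-by-value Above? (λ f → toℕ (f z)) c k bounds (allFuns (n + suc i) (n + suc i)) ⟩
      ∑[ j < k ] count (λ f → Above? f ×-dec (toℕ (f z) ℕ.≟ c + j))
        ≡⟨ ∑-cong k (λ j _ → count-≐ {n + suc i} _ _ ((λ ((d , _) , e) → d , e) ,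
                                                      (λ (d , e) → (d , subst (c ≤_) (sym e) (m≤m+n c j)) , e))) ⟩
      ∑[ j < k ] σ[ extend G v (suc i) ∣ z ≡ c + j ]
        ≡⟨ ∑-cong k (λ j j<k → trans (cong (σ[ extend G v (suc i) ∣_≡ c + j ]) (sym (new≡chainEnd i)))
                               (trans (σ-relabel (ℕ._≟ c + j) (sym (+-suc n i)) (extend G v (suc i)) (fromℕ (n + i)))
                                      (σ-pendant (extend-pendant i) (label-bound j<k)))) ⟩
      ∑[ j < k ] σ≥ i (c + j) ∎
      where
      open ≡-Reasoning
      z = chainEnd (suc i)
      Above? = λ f → isDisposition? (extend G v (suc i)) f ×-dec (c ≤? toℕ (f z))
      bounds : ∀ {f} → IsDisposition (extend G v (suc i)) f × c ≤ toℕ (f z) → c ≤ toℕ (f z) × toℕ (f z) < c + k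
      bounds {f} (_ , c≤fz) = c≤fz , subst (toℕ (f z) <_) (sym c+k≡) (toℕ<n (f z))
      label-bound : ∀ {j} → j < k → c + j < suc (n + i)
      label-bound {j} j<k = subst (c + j <_) (trans c+k≡ (+-suc n i)) (+-monoʳ-< c j<k)

    -- z₁ > ⋯ > z_i take i of the d labels in [c, a + i), the root takes a + i, and the rest is a disposition of G.
    σ≥-binomial : ∀ i c d → c + d ≡ a + i → σ≥ i c ≡ σ G * (d C i)
    σ≥-binomial zero    c d c+d≡a+0 =
      trans (σ≥-zero c (subst (c ≤_) (trans c+d≡a+0 (+-identityʳ a)) (m≤m+n c d))) (sym (*-identityʳ (σ G)))
    σ≥-binomial (suc i) c d c+d≡a+1+i =
      trans (σ≥-suc i c (suc d) (trans (+-suc c d) (cong suc c+d≡a+1+i)))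
            (∑-hockey-stick (σ≥ i) (σ G) i (a + i) (σ≥-binomial i) (σ[∣≥m]≡0 (extend G v i) (chainEnd i))
                            c d (trans c+d≡a+1+i (+-suc a i)))

    σ-extend : ∀ i → σ (extend G v i) ≡ σ G * ((a + i) C i)
    σ-extend i = trans (count-≐ {n + i} _ _ ((λ d → d , z≤n) , proj₁)) (σ≥-binomial i 0 (a + i) refl)

module CompanionSeries where

  open import Data.Nat as ℕ using (ℕ; zero; suc; _∸_; _!; _≤_; z≤n)
  import Data.Nat.Properties as ℕ
  open import Data.Nat.Properties using (_!≢0)
  open import Data.Nat.Combinatorics using (_C_; nCk≡nC[n∸k])
  open import Data.Nat.Coprimality using (1-coprimeTo) renaming (sym to coprime-sym)
  open import Data.Integer as ℤ using (+_)
  import Data.Integer.Properties as ℤ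
  open import Data.Rational using (ℚ; mkℚ; 1ℚ; _+_; _*_; _/_)
  open import Data.Rational.Properties
    using (normalize-coprime; /-cong; *-inverseʳ; *-identityʳ; *-assoc; *-distribˡ-+; *-distribʳ-+; +-0-group)
  open import Data.Rational.Solver using (module +-*-Solver)
  open import Algebra.Properties.Group +-0-group using (∙-cancelˡ)
  open import Data.Sum using (inj₁; inj₂)
  open import Relation.Binary.PropositionalEquality
  open import Relation.Nullary using (contradiction)
  open import Defs
  open Counting using (∑; ∑-snoc)
  open Binomial using (nCk*k!*[n∸k]!≡n!; vandermonde)
  open +-*-Solver

  toℚ : ℕ → ℚ
  toℚ n = + n / 1

  private
    toℚ≡mkℚ : ∀ n → toℚ n ≡ mkℚ (+ n) 0 (coprime-sym (1-coprimeTo n))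
    toℚ≡mkℚ n = normalize-coprime (coprime-sym (1-coprimeTo n))

  toℚ-+ : ∀ m n → toℚ (m ℕ.+ n) ≡ toℚ m + toℚ n
  toℚ-+ m n = sym (trans (cong₂ _+_ (toℚ≡mkℚ m) (toℚ≡mkℚ n))
    (/-cong (trans (cong₂ ℤ._+_ (ℤ.*-identityʳ (+ m)) (ℤ.*-identityʳ (+ n))) (sym (ℤ.pos-+ m n))) refl))

  toℚ-* : ∀ m n → toℚ (m ℕ.* n) ≡ toℚ m * toℚ n
  toℚ-* m n = sym (trans (cong₂ _*_ (toℚ≡mkℚ m) (toℚ≡mkℚ n)) (/-cong (sym (ℤ.pos-* m n)) refl))

  toℚ-*-inverse : ∀ d .{{_ : ℕ.NonZero d}} → toℚ d * (+ 1 / d) ≡ 1ℚ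
  toℚ-*-inverse zero    = contradiction refl (ℕ.≢-nonZero⁻¹ 0)
  toℚ-*-inverse (suc e) = trans (cong₂ _*_ (toℚ≡mkℚ (suc e)) (normalize-coprime (1-coprimeTo (suc e))))
                                (*-inverseʳ (mkℚ (+ suc e) 0 (coprime-sym (1-coprimeTo (suc e)))))

  toℚ-!-*-inv! : ∀ k → toℚ (k !) * inv! k ≡ 1ℚ
  toℚ-!-*-inv! k = toℚ-*-inverse (k !) {{k !≢0}}

  inv!-*-inv! : ∀ {i k} → k ≤ i → inv! k * inv! (i ∸ k) ≡ toℚ (i C k) * inv! i
  inv!-*-inv! {i} {k} k≤i = begin
    A * B
      ≡⟨ sym (*-identityʳ (A * B)) ⟩
    A * B * 1ℚ
      ≡⟨ cong (A * B *_) (sym (toℚ-!-*-inv! i)) ⟩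
    A * B * (toℚ (i !) * I)
      ≡⟨ cong (λ x → A * B * (toℚ x * I)) (sym (nCk*k!*[n∸k]!≡n! k≤i)) ⟩
    A * B * (toℚ ((i C k) ℕ.* (k ! ℕ.* (i ∸ k) !)) * I)
      ≡⟨ cong (λ x → A * B * (x * I)) (trans (toℚ-* (i C k) _) (cong (toℚ (i C k) *_) (toℚ-* (k !) _))) ⟩
    A * B * (toℚ (i C k) * (toℚ (k !) * toℚ ((i ∸ k) !)) * I)
      ≡⟨ solve 6 (λ A B C K J I → A :* B :* (C :* (K :* J) :* I) := C :* I :* (K :* A) :* (J :* B))
               refl A B (toℚ (i C k)) (toℚ (k !)) (toℚ ((i ∸ k) !)) I ⟩
    toℚ (i C k) * I * (toℚ (k !) * A) * (toℚ ((i ∸ k) !) * B)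
      ≡⟨ cong₂ (λ x y → toℚ (i C k) * I * x * y) (toℚ-!-*-inv! k) (toℚ-!-*-inv! (i ∸ k)) ⟩
    toℚ (i C k) * I * 1ℚ * 1ℚ
      ≡⟨ trans (*-identityʳ _) (*-identityʳ _) ⟩
    toℚ (i C k) * I ∎
    where
    open ≡-Reasoning
    A = inv! k
    B = inv! (i ∸ k)
    I = inv! i

  sign*sign : ∀ k → sign k * sign k ≡ 1ℚ
  sign*sign zero    = refl
  sign*sign (suc k) = trans (solve 1 (λ p → (:- p) :* (:- p) := p :* p) refl (sign k)) (sign*sign k)

  Σ≤-cong : ∀ i {f g : ℕ → ℚ} → (∀ k → k ≤ i → f k ≡ g k) → Σ≤ i f ≡ Σ≤ i g
  Σ≤-cong zero    f≡g = f≡g 0 z≤n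
  Σ≤-cong (suc i) f≡g = cong₂ _+_ (Σ≤-cong i (λ k k≤i → f≡g k (ℕ.m≤n⇒m≤1+n k≤i))) (f≡g (suc i) ℕ.≤-refl)

  *-distribˡ-Σ≤ : ∀ c i (f : ℕ → ℚ) → c * Σ≤ i f ≡ Σ≤ i (λ k → c * f k)
  *-distribˡ-Σ≤ c zero    f = refl
  *-distribˡ-Σ≤ c (suc i) f = trans (*-distribˡ-+ c (Σ≤ i f) (f (suc i))) (cong (_+ c * f (suc i)) (*-distribˡ-Σ≤ c i f))

  Σ≤-toℚ : ∀ i (x : ℕ → ℕ) c → Σ≤ i (λ k → toℚ (x k) * c) ≡ toℚ (∑[ k < suc i ] x k) * c
  Σ≤-toℚ zero    x c = cong (λ y → toℚ y * c) (sym (ℕ.+-identityʳ (x 0)))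
  Σ≤-toℚ (suc i) x c = begin
    Σ≤ i (λ k → toℚ (x k) * c) + toℚ (x (suc i)) * c
      ≡⟨ cong (_+ toℚ (x (suc i)) * c) (Σ≤-toℚ i x c) ⟩
    toℚ (∑[ k < suc i ] x k) * c + toℚ (x (suc i)) * c
      ≡⟨ sym (*-distribʳ-+ c (toℚ (∑[ k < suc i ] x k)) (toℚ (x (suc i)))) ⟩
    (toℚ (∑[ k < suc i ] x k) + toℚ (x (suc i))) * c
      ≡⟨ cong (_* c) (sym (toℚ-+ (∑[ k < suc i ] x k) (x (suc i)))) ⟩
    toℚ (∑[ k < suc i ] x k ℕ.+ x (suc i)) * c
      ≡⟨ cong (λ y → toℚ y * c) (sym (∑-snoc (suc i) x)) ⟩
    toℚ (∑[ k < suc (suc i) ] x k) * c ∎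
    where open ≡-Reasoning

  mulExpCoeff-scale : ∀ c t i → mulExpCoeff (λ k → c * t k) i ≡ c * mulExpCoeff t i
  mulExpCoeff-scale c t i =
    trans (Σ≤-cong i (λ k _ → *-assoc c (t k) (inv! (i ∸ k)))) (sym (*-distribˡ-Σ≤ c i _))

  -- The coefficient of X^k in t·exp(X) is t k plus a combination of t 0, …, t (k - 1).
  mulExpCoeff-injective : ∀ {t s} → (∀ i → mulExpCoeff t i ≡ mulExpCoeff s i) → ∀ k → t k ≡ s k
  mulExpCoeff-injective {t} {s} t≈s k = agree-up-to k k ℕ.≤-refl
    where
    inv![k∸k]≡1 : ∀ k → inv! (k ∸ k) ≡ 1ℚ
    inv![k∸k]≡1 k = cong inv! (ℕ.n∸n≡0 k)

    agree-up-to : ∀ k j → j ≤ k → t j ≡ s j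
    agree-up-to zero    zero z≤n = trans (sym (*-identityʳ (t 0))) (trans (t≈s 0) (*-identityʳ (s 0)))
    agree-up-to (suc k) j    j≤1+k with ℕ.m≤n⇒m<n∨m≡n j≤1+k
    ... | inj₁ j<1+k = agree-up-to k j (ℕ.≤-pred j<1+k)
    ... | inj₂ refl  = begin
      t (suc k)                 ≡⟨ sym (*-identityʳ _) ⟩
      t (suc k) * 1ℚ            ≡⟨ cong (t (suc k) *_) (sym (inv![k∸k]≡1 k)) ⟩
      t (suc k) * inv! (k ∸ k)  ≡⟨ ∙-cancelˡ (Σ≤ k (λ j → s j * inv! (suc k ∸ j))) _ _
                                     (trans (cong (_+ t (suc k) * inv! (k ∸ k)) (sym lower-terms)) (t≈s (suc k))) ⟩
      s (suc k) * inv! (k ∸ k)  ≡⟨ cong (s (suc k) *_) (inv![k∸k]≡1 k) ⟩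
      s (suc k) * 1ℚ            ≡⟨ *-identityʳ _ ⟩
      s (suc k) ∎
      where
      open ≡-Reasoning
      lower-terms : Σ≤ k (λ j → t j * inv! (suc k ∸ j)) ≡ Σ≤ k (λ j → s j * inv! (suc k ∸ j))
      lower-terms = Σ≤-cong k (λ j j≤k → cong (_* inv! (suc k ∸ j)) (agree-up-to k j j≤k))

  mulExpCoeff-laguerre : ∀ a i → mulExpCoeff (negArg (laguerre a)) i ≡ toℚ ((a ℕ.+ i) C i) * inv! i
  mulExpCoeff-laguerre a i = begin
    Σ≤ i (λ k → sign k * (toℚ (a C k) * sign k * inv! k) * inv! (i ∸ k))
      ≡⟨ Σ≤-cong i term ⟩
    Σ≤ i (λ k → toℚ ((a C k) ℕ.* (i C (i ∸ k))) * inv! i)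
      ≡⟨ Σ≤-toℚ i (λ k → (a C k) ℕ.* (i C (i ∸ k))) (inv! i) ⟩
    toℚ (∑[ k < suc i ] ((a C k) ℕ.* (i C (i ∸ k)))) * inv! i
      ≡⟨ cong (λ x → toℚ x * inv! i) (vandermonde a i i) ⟩
    toℚ ((a ℕ.+ i) C i) * inv! i ∎
    where
    open ≡-Reasoning
    term : ∀ k → k ≤ i →
           sign k * (toℚ (a C k) * sign k * inv! k) * inv! (i ∸ k) ≡ toℚ ((a C k) ℕ.* (i C (i ∸ k))) * inv! i
    term k k≤i = begin
      sign k * (toℚ (a C k) * sign k * inv! k) * inv! (i ∸ k)
        ≡⟨ solve 4 (λ σ c A B → σ :* (c :* σ :* A) :* B := c :* (σ :* σ) :* (A :* B))
                 refl (sign k) (toℚ (a C k)) (inv! k) (inv! (i ∸ k)) ⟩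
      toℚ (a C k) * (sign k * sign k) * (inv! k * inv! (i ∸ k))
        ≡⟨ cong₂ (λ x y → toℚ (a C k) * x * y) (sign*sign k) (inv!-*-inv! k≤i) ⟩
      toℚ (a C k) * 1ℚ * (toℚ (i C k) * inv! i)
        ≡⟨ solve 3 (λ c d I → c :* con 1ℚ :* (d :* I) := c :* d :* I) refl (toℚ (a C k)) (toℚ (i C k)) (inv! i) ⟩
      toℚ (a C k) * toℚ (i C k) * inv! i
        ≡⟨ cong (_* inv! i) (trans (sym (toℚ-* (a C k) (i C k))) (cong (λ x → toℚ ((a C k) ℕ.* x)) (nCk≡nC[n∸k] k≤i))) ⟩
      toℚ ((a C k) ℕ.* (i C (i ∸ k))) * inv! i ∎

  mulExpCoeff-scaled-laguerre : ∀ a s (S : ℕ → ℕ) → (∀ i → S i ≡ s ℕ.* ((a ℕ.+ i) C i)) →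
                                ∀ i → mulExpCoeff (λ k → toℚ s * negArg (laguerre a) k) i ≡ toℚ (S i) * inv! i
  mulExpCoeff-scaled-laguerre a s S S≡ i = begin
    mulExpCoeff (λ k → toℚ s * negArg (laguerre a) k) i ≡⟨ mulExpCoeff-scale (toℚ s) (negArg (laguerre a)) i ⟩
    toℚ s * mulExpCoeff (negArg (laguerre a)) i          ≡⟨ cong (toℚ s *_) (mulExpCoeff-laguerre a i) ⟩
    toℚ s * (toℚ ((a ℕ.+ i) C i) * inv! i)              ≡⟨ sym (*-assoc (toℚ s) _ _) ⟩
    toℚ s * toℚ ((a ℕ.+ i) C i) * inv! i                 ≡⟨ cong (_* inv! i) (sym (toℚ-* s _)) ⟩
    toℚ (s ℕ.* ((a ℕ.+ i) C i)) * inv! i                 ≡⟨ cong (λ x → toℚ x * inv! i) (sym (S≡ i)) ⟩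
    toℚ (S i) * inv! i ∎
    where open ≡-Reasoning

open import Defs
open import Data.Nat using (ℕ; zero; suc; _∸_)
open import Data.Fin using (Fin)
open import Data.Rational using (_*_)
open import Data.Product using (_,_)
open import Relation.Binary.PropositionalEquality using (sym; trans)
open Dispositions using (σ-extend)
open CompanionSeries using (mulExpCoeff-injective; mulExpCoeff-scaled-laguerre)

mainTheorem9 : ∀ {n} (G : Digraph n) (v : Fin n) → IsRootedTreeDigraph G v →
    CompanionIs G v (λ k → σℚ G * negArg (laguerre (n ∸ 1)) k)
mainTheorem9 {zero}  G () tree
mainTheorem9 {suc a} G v  tree = isCompanion , λ t t-isCompanion →
  mulExpCoeff-injective (λ i → trans (t-isCompanion i) (sym (isCompanion i)))
  where
  isCompanion : IsCompanion G v (λ k → σℚ G * negArg (laguerre a) k)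
  isCompanion = mulExpCoeff-scaled-laguerre a (σ G) (λ i → σ (extend G v i)) (σ-extend tree)
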